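{- Let $i,j,z \in \mathbb{N}$ and let $Y$ be any Young diagram with $z$ steps. Then $Y$ admits an $(i,j)$-local cover if and only if $Y_z$ admits an $(i,j)$-local cover consisting of exactly $z$ rectangles.
   Context: For $x \in \mathbb{N}$ let $[x] = \{1,\ldots,x\}$. A Young diagram with $r$ rows and $c$ columns is a subset $Y \subseteq [r] \times [c]$ such that whenever $(i,j) \in Y$, then $(i-1,j) \in Y$ if $i \geq 2$ and $(i,j-1) \in Y$ if $j \geq 2$. The steps of $Y$ are the elements of $Z = \{(s,t) \in Y : (s+1,t) \notin Y \text{ and } (s,t+1) \notin Y\}$. A (generalized) rectangle in $Y$ is a set $R = S \times T$ with $S \subseteq [r]$, $T \subseteq [c]$ and $R \subseteq Y$; it uses the rows in $S$ and the columns in $T$. A cover of $Y$ is a set $C$ of such rectangles with $Y = \bigcup_{R \in C} R$. A cover $C$ is $(i,j)$-local if each row of $Y$ is used by at most $i$ rectangles of $C$ and each column of $Y$ is used by at most $j$ rectangles of $C$. For $z \in \mathbb{N}$, $Y_z = \{(s,t) \in [z] \times [z] : s + t \leq z+1\}$ (the Young diagram with $z$ rows, $z$ columns and $z$ steps). -}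

module Defs where

open import Data.Nat using (ℕ; zero; suc; _+_; _≤_; _≤ᵇ_)
open import Data.Bool using (Bool; true; false; _∧_; not; if_then_else_)
open import Data.List using (List; []; _∷_; map; upTo)
open import Data.Nat.ListAction using (sum)
open import Data.Product using (Σ; _×_; _,_; ∃)
open import Data.List.Membership.Propositional using (_∈_)
open import Relation.Binary.PropositionalEquality using (_≡_)

-- A set of cells given by its characteristic function; cell (s , t) is
-- row s, column t, with 1-based indices as in the paper.
Diagram : Set
Diagram = ℕ → ℕ → Bool

record IsYoungDiagram (r c : ℕ) (Y : Diagram) : Set where
  field
    bounded  : ∀ s t → Y s t ≡ true → (1 ≤ s × s ≤ r) × (1 ≤ t × t ≤ c)
    down-row : ∀ s t → Y (suc s) t ≡ true → 1 ≤ s → Y s t ≡ true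
    down-col : ∀ s t → Y s (suc t) ≡ true → 1 ≤ t → Y s t ≡ true

isStep : Diagram → ℕ → ℕ → Bool
isStep Y s t = Y s t ∧ not (Y (suc s) t) ∧ not (Y s (suc t))

range1 : ℕ → List ℕ
range1 n = map suc (upTo n)

numSteps : ℕ → ℕ → Diagram → ℕ
numSteps r c Y =
  sum (map (λ s → sum (map (λ t → if isStep Y s t then 1 else 0) (range1 c))) (range1 r))

record Rectangle (r c : ℕ) (Y : Diagram) : Set where
  field
    S     : ℕ → Bool
    T     : ℕ → Bool
    S-sub : ∀ s → S s ≡ true → 1 ≤ s × s ≤ r
    T-sub : ∀ t → T t ≡ true → 1 ≤ t × t ≤ c
    inY   : ∀ s t → S s ≡ true → T t ≡ true → Y s t ≡ true

open Rectangle

rowUses : ∀ {r c Y} → List (Rectangle r c Y) → ℕ → ℕ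
rowUses []      s = 0
rowUses (R ∷ C) s = (if S R s then 1 else 0) + rowUses C s

colUses : ∀ {r c Y} → List (Rectangle r c Y) → ℕ → ℕ
colUses []      t = 0
colUses (R ∷ C) t = (if T R t then 1 else 0) + colUses C t

-- C is an (i,j)-local cover of Y (rectangles are contained in Y by
-- definition, so covering Y means Y = ⋃ C).
record IsLocalCover (r c : ℕ) (Y : Diagram) (i j : ℕ)
                    (C : List (Rectangle r c Y)) : Set where
  field
    covers   : ∀ s t → Y s t ≡ true →
               ∃ λ R → R ∈ C × S R s ≡ true × T R t ≡ true
    rowLocal : ∀ s → rowUses C s ≤ i
    colLocal : ∀ t → colUses C t ≤ j

Ystair : ℕ → Diagram
Ystair z s t = (1 ≤ᵇ s) ∧ (1 ≤ᵇ t) ∧ (s + t ≤ᵇ suc z)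

-- Write the steps of Y, from top right to bottom left, as (p a, q b) with a + b = z + 1, where p
-- and q are strictly increasing; Y consists of the cells weakly above and left of some step.
-- Hence Y_z is the preimage of Y under (a, b) ↦ (p a, q b), and Y is the preimage of Y_z under
-- (s, t) ↦ (φ s, ψ t), where φ s is the least a with s ≤ p a and ψ t the least b with t ≤ q b.
-- Pulling a cover back along such a map yields a cover using no row or column more often.
-- Finally, in a cover of a Young diagram the rectangles with the same last row k merge into a
-- single rectangle (all their columns meet row k), leaving one rectangle per row and again no
-- extra uses.

module Submission where

open import Defs
open import Data.Bool using (Bool; true; false; _∧_; _∨_; not; if_then_else_)
open import Data.Bool.ListAction using (any)
open import Data.Bool.Properties using (T-≡; ∧-zeroʳ)
open import Data.Empty using (⊥-elim)
open import Data.List using (List; []; _∷_; length; map; upTo; applyUpTo)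
open import Data.List.Membership.Propositional using (_∈_; lose)
open import Data.List.Membership.Propositional.Properties using (∈-map⁺; ∈-upTo⁺)
open import Data.List.Properties using (map-∘; map-upTo; length-map; length-upTo)
open import Data.List.Relation.Unary.Any using (satisfied)
open import Data.List.Relation.Unary.Any.Properties using (any⁺; any⁻)
open import Data.Nat using (ℕ; zero; suc; pred; _+_; _∸_; _≤_; _<_; _≤′_; ≤′-refl; ≤′-step; z≤n; s≤s; _≤ᵇ_; _≡ᵇ_)
open import Data.Nat.ListAction using (sum)
open import Data.Nat.Properties
open import Data.Product using (Σ; ∃; ∃₂; _×_; _,_; proj₁; proj₂)
open import Data.Sum using (_⊎_; inj₁; inj₂)
open import Function.Base using (_∘_)
open import Function.Bundles using (_⇔_; mk⇔; Equivalence)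
open import Relation.Binary.Definitions using (tri<; tri≈; tri>)
open import Relation.Binary.PropositionalEquality

open IsYoungDiagram
open Rectangle
open IsLocalCover

true≢false : true ≢ false
true≢false ()

∧-true⁻ : ∀ {x y} → x ∧ y ≡ true → x ≡ true × y ≡ true
∧-true⁻ {true} e = refl , e

∧-true⁺ : ∀ {x y} → x ≡ true → y ≡ true → x ∧ y ≡ true
∧-true⁺ refl refl = refl

≤ᵇ-true⁻ : ∀ {m n} → (m ≤ᵇ n) ≡ true → m ≤ n
≤ᵇ-true⁻ {m} {n} e = ≤ᵇ⇒≤ m n (Equivalence.from T-≡ e)

≤ᵇ-true⁺ : ∀ {m n} → m ≤ n → (m ≤ᵇ n) ≡ true
≤ᵇ-true⁺ m≤n = Equivalence.to T-≡ (≤⇒≤ᵇ m≤n)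

≡ᵇ-true⁻ : ∀ {m n} → (m ≡ᵇ n) ≡ true → m ≡ n
≡ᵇ-true⁻ {m} {n} e = ≡ᵇ⇒≡ m n (Equivalence.from T-≡ e)

≡ᵇ-refl : ∀ n → (n ≡ᵇ n) ≡ true
≡ᵇ-refl n = Equivalence.to T-≡ (≡⇒≡ᵇ n n refl)

any-true⁻ : ∀ {A : Set} (p : A → Bool) xs → any p xs ≡ true → ∃ λ x → p x ≡ true
any-true⁻ p xs e with satisfied (any⁻ p xs (Equivalence.from T-≡ e))
... | x , px = x , Equivalence.to T-≡ px

any-true⁺ : ∀ {A : Set} (p : A → Bool) {x xs} → x ∈ xs → p x ≡ true → any p xs ≡ true
any-true⁺ p x∈xs px = Equivalence.to T-≡ (any⁺ p (lose x∈xs (Equivalence.from T-≡ px)))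

count : ∀ {A : Set} → (A → Bool) → List A → ℕ
count P xs = sum (map (λ x → if P x then 1 else 0) xs)

module _ {A : Set} where

  count-none : ∀ (P : A → Bool) xs → (∀ x → P x ≡ false) → count P xs ≡ 0
  count-none P []       none = refl
  count-none P (x ∷ xs) none rewrite none x = count-none P xs none

  count-mono : ∀ (P Q : A → Bool) xs → (∀ x → P x ≡ true → Q x ≡ true) → count P xs ≤ count Q xs
  count-mono P Q []       P⇒Q = z≤n
  count-mono P Q (x ∷ xs) P⇒Q with P x in px
  ... | true  rewrite P⇒Q x px = s≤s (count-mono P Q xs P⇒Q)
  ... | false = ≤-trans (count-mono P Q xs P⇒Q) (m≤n+m _ _)

  count-∨ : ∀ (P Q : A → Bool) xs → count (λ x → P x ∨ Q x) xs ≤ count P xs + count Q xs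
  count-∨ P Q []       = z≤n
  count-∨ P Q (x ∷ xs) with P x | Q x
  ... | true  | true  = s≤s (≤-trans (count-∨ P Q xs) (+-monoʳ-≤ (count P xs) (n≤1+n _)))
  ... | true  | false = s≤s (count-∨ P Q xs)
  ... | false | true  = ≤-trans (s≤s (count-∨ P Q xs)) (≤-reflexive (sym (+-suc _ _)))
  ... | false | false = count-∨ P Q xs

count-map : ∀ {A B : Set} (P : B → Bool) (f : A → B) xs → count P (map f xs) ≡ count (P ∘ f) xs
count-map P f xs = cong sum (sym (map-∘ xs))

map-range1 : ∀ {A : Set} (f : ℕ → A) n → map f (range1 n) ≡ applyUpTo (f ∘ suc) n
map-range1 f n = trans (sym (map-∘ (upTo n))) (map-upTo (f ∘ suc) n)

∈-range1 : ∀ {k n} → 1 ≤ k → k ≤ n → k ∈ range1 n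
∈-range1 {suc k} _ k<n = ∈-map⁺ suc (∈-upTo⁺ k<n)

sum-applyUpTo-zero : ∀ (f : ℕ → ℕ) n → (∀ i → f i ≡ 0) → sum (applyUpTo f n) ≡ 0
sum-applyUpTo-zero f zero    f≡0 = refl
sum-applyUpTo-zero f (suc n) f≡0 rewrite f≡0 0 = sum-applyUpTo-zero (f ∘ suc) n (f≡0 ∘ suc)

sum-applyUpTo-single : ∀ (f : ℕ → ℕ) m n → (∀ i → i ≢ m → f i ≡ 0) → sum (applyUpTo f n) ≤ f m
sum-applyUpTo-single f m       zero    f≡0 = z≤n
sum-applyUpTo-single f zero    (suc n) f≡0
  rewrite sum-applyUpTo-zero (f ∘ suc) n (λ i → f≡0 (suc i) λ ()) = ≤-reflexive (+-identityʳ (f 0))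
sum-applyUpTo-single f (suc m) (suc n) f≡0
  rewrite f≡0 0 λ () = sum-applyUpTo-single (f ∘ suc) m n (λ i i≢m → f≡0 (suc i) (i≢m ∘ suc-injective))

sum-applyUpTo-single-< : ∀ (f : ℕ → ℕ) {m n} → m < n → (∀ i → i ≢ m → f i ≡ 0) → sum (applyUpTo f n) ≡ f m
sum-applyUpTo-single-< f {zero}  {suc n} m<n f≡0
  rewrite sum-applyUpTo-zero (f ∘ suc) n (λ i → f≡0 (suc i) λ ()) = +-identityʳ (f 0)
sum-applyUpTo-single-< f {suc m} {suc n} (s≤s m<n) f≡0
  rewrite f≡0 0 λ () = sum-applyUpTo-single-< (f ∘ suc) m<n (λ i i≢m → f≡0 (suc i) (i≢m ∘ suc-injective))

count-≡ᵇ-≤1 : ∀ m n → count (m ≡ᵇ_) (range1 n) ≤ 1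
count-≡ᵇ-≤1 m n = begin
  count (m ≡ᵇ_) (range1 n)              ≡⟨ cong sum (map-range1 ind n) ⟩
  sum (applyUpTo (ind ∘ suc) n)         ≤⟨ sum-applyUpTo-single (ind ∘ suc) (pred m) n off-m ⟩
  ind (suc (pred m))                    ≤⟨ ind≤1 (suc (pred m)) ⟩
  1                                     ∎
  where
  open ≤-Reasoning
  ind : ℕ → ℕ
  ind k = if m ≡ᵇ k then 1 else 0
  ind≤1 : ∀ k → ind k ≤ 1
  ind≤1 k with m ≡ᵇ k
  ... | true  = ≤-refl
  ... | false = z≤n
  off-m : ∀ i → i ≢ pred m → ind (suc i) ≡ 0
  off-m i i≢m with m ≡ᵇ suc i in e
  ... | true  = ⊥-elim (i≢m (cong pred (sym (≡ᵇ-true⁻ {m} e))))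
  ... | false = refl

count-≡ᵇ-∧-≤ : ∀ m n b → count (λ k → (m ≡ᵇ k) ∧ b) (range1 n) ≤ (if b then 1 else 0)
count-≡ᵇ-∧-≤ m n true  = ≤-trans (count-mono _ (m ≡ᵇ_) (range1 n) (λ _ → proj₁ ∘ ∧-true⁻)) (count-≡ᵇ-≤1 m n)
count-≡ᵇ-∧-≤ m n false = ≤-reflexive (count-none _ (range1 n) (λ k → ∧-zeroʳ (m ≡ᵇ k)))

greatest : (ℕ → Bool) → ℕ → ℕ
greatest P zero    = zero
greatest P (suc n) = if P (suc n) then suc n else greatest P n

greatest-≤ : ∀ P n → greatest P n ≤ n
greatest-≤ P zero    = z≤n
greatest-≤ P (suc n) with P (suc n)
... | true  = ≤-refl
... | false = m≤n⇒m≤1+n (greatest-≤ P n)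

greatest-true : ∀ P n → 1 ≤ greatest P n → P (greatest P n) ≡ true
greatest-true P (suc n) 1≤g with P (suc n) in e
... | true  = e
... | false = greatest-true P n 1≤g

≤-greatest : ∀ P n {t} → P t ≡ true → t ≤ n → t ≤ greatest P n
≤-greatest P zero    Pt t≤n = t≤n
≤-greatest P (suc n) Pt t≤n with P (suc n) in e | m≤n⇒m<n∨m≡n t≤n
... | true  | _              = t≤n
... | false | inj₁ (s≤s t≤n′) = ≤-greatest P n Pt t≤n′
... | false | inj₂ refl      = ⊥-elim (true≢false (trans (sym Pt) e))

least : (ℕ → Bool) → ℕ → ℕ
least P zero    = 1
least P (suc n) = if P 1 then 1 else suc (least (P ∘ suc) n)

1≤least : ∀ P n → 1 ≤ least P n
1≤least P zero    = s≤s z≤n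
1≤least P (suc n) with P 1
... | true  = s≤s z≤n
... | false = s≤s z≤n

least-true : ∀ P n → least P n ≤ n → P (least P n) ≡ true
least-true P (suc n) l≤n with P 1 in e
... | true  = e
... | false = least-true (P ∘ suc) n (≤-pred l≤n)

least-minimal : ∀ P n {k} → 1 ≤ k → k ≤ n → P k ≡ true → least P n ≤ k
least-minimal P (suc n) {suc k} _ k≤n Pk with P 1 in e
... | true  = s≤s z≤n
least-minimal P (suc n) {suc zero}    _ k≤n Pk | false = ⊥-elim (true≢false (trans (sym Pk) e))
least-minimal P (suc n) {suc (suc k)} _ k≤n Pk | false =
  s≤s (least-minimal (P ∘ suc) n (s≤s z≤n) (≤-pred k≤n) Pk)

sum≤suc⇒≤ʳ : ∀ {a b z} → 1 ≤ a → a + b ≤ suc z → b ≤ z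
sum≤suc⇒≤ʳ {a} {b} 1≤a a+b≤ = ≤-pred (≤-trans (+-monoˡ-≤ b 1≤a) a+b≤)

sum≤suc⇒≤ˡ : ∀ {a b z} → 1 ≤ b → a + b ≤ suc z → a ≤ z
sum≤suc⇒≤ˡ {a} {b} 1≤b a+b≤ = sum≤suc⇒≤ʳ 1≤b (≤-trans (≤-reflexive (+-comm b a)) a+b≤)

complement : ∀ {a z} → 1 ≤ a → a ≤ z → ∃ λ b → 1 ≤ b × a + b ≡ suc z
complement {a} {z} 1≤a a≤z = suc z ∸ a , m<n⇒0<n∸m (s≤s a≤z) , m+[n∸m]≡n (m≤n⇒m≤1+n a≤z)

module _ {r c : ℕ} {Y : Diagram} (yd : IsYoungDiagram r c Y) where

  down-cols : ∀ {s t t′} → 1 ≤ t → t ≤ t′ → Y s t′ ≡ true → Y s t ≡ true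
  down-cols 1≤t t≤t′ = go (≤⇒≤′ t≤t′)
    where
    go : ∀ {s t′} → _ ≤′ t′ → Y s t′ ≡ true → Y s _ ≡ true
    go ≤′-refl          e = e
    go (≤′-step t≤′t′) e = go t≤′t′ (down-col yd _ _ e (≤-trans 1≤t (≤′⇒≤ t≤′t′)))

  down-rows : ∀ {s s′ t} → 1 ≤ s → s ≤ s′ → Y s′ t ≡ true → Y s t ≡ true
  down-rows 1≤s s≤s′ = go (≤⇒≤′ s≤s′)
    where
    go : ∀ {s′ t} → _ ≤′ s′ → Y s′ t ≡ true → Y _ t ≡ true
    go ≤′-refl          e = e
    go (≤′-step s≤′s′) e = go s≤′s′ (down-row yd _ _ e (≤-trans 1≤s (≤′⇒≤ s≤′s′)))

Ystair⁺ : ∀ {z s t} → 1 ≤ s → 1 ≤ t → s + t ≤ suc z → Ystair z s t ≡ true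
Ystair⁺ 1≤s 1≤t s+t≤ = ∧-true⁺ (≤ᵇ-true⁺ 1≤s) (∧-true⁺ (≤ᵇ-true⁺ 1≤t) (≤ᵇ-true⁺ s+t≤))

Ystair⁻ : ∀ {z s t} → Ystair z s t ≡ true → (1 ≤ s × 1 ≤ t) × s + t ≤ suc z
Ystair⁻ {z} {s} e with ∧-true⁻ {1 ≤ᵇ s} e
... | e₁ , e₂₃ with ∧-true⁻ e₂₃
... | e₂ , e₃ = (≤ᵇ-true⁻ e₁ , ≤ᵇ-true⁻ e₂) , ≤ᵇ-true⁻ e₃

Ystair-young : ∀ z → IsYoungDiagram z z (Ystair z)
Ystair-young z = record
  { bounded  = λ s t e → let ((1≤s , 1≤t) , s+t≤) = Ystair⁻ e in
                         (1≤s , sum≤suc⇒≤ˡ 1≤t s+t≤) , (1≤t , sum≤suc⇒≤ʳ 1≤s s+t≤)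
  ; down-row = λ s t e 1≤s → let ((_ , 1≤t) , s+t≤) = Ystair⁻ e in
                             Ystair⁺ 1≤s 1≤t (≤-trans (+-monoˡ-≤ t (n≤1+n s)) s+t≤)
  ; down-col = λ s t e 1≤t → let ((1≤s , _) , s+t≤) = Ystair⁻ e in
                             Ystair⁺ 1≤s 1≤t (≤-trans (+-monoʳ-≤ s (n≤1+n t)) s+t≤)
  }

module _ {r c : ℕ} {Y : Diagram} where

  rowUses-count : ∀ (C : List (Rectangle r c Y)) s → rowUses C s ≡ count (λ R → S R s) C
  rowUses-count []      s = refl
  rowUses-count (R ∷ C) s = cong (_ +_) (rowUses-count C s)

  colUses-count : ∀ (C : List (Rectangle r c Y)) t → colUses C t ≡ count (λ R → T R t) C
  colUses-count []      t = refl
  colUses-count (R ∷ C) t = cong (_ +_) (colUses-count C t)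

module _ {r c r′ c′ : ℕ} {Y Y′ : Diagram} where

  rowUses-map-≤ : ∀ (F : Rectangle r c Y → Rectangle r′ c′ Y′) C {s s′} →
                  (∀ R → S (F R) s ≡ true → S R s′ ≡ true) → rowUses (map F C) s ≤ rowUses C s′
  rowUses-map-≤ F C {s} {s′} F⇒ = begin
    rowUses (map F C) s             ≡⟨ rowUses-count (map F C) s ⟩
    count (λ R → S R s) (map F C)   ≡⟨ count-map (λ R → S R s) F C ⟩
    count (λ R → S (F R) s) C       ≤⟨ count-mono _ _ C F⇒ ⟩
    count (λ R → S R s′) C          ≡⟨ rowUses-count C s′ ⟨
    rowUses C s′                    ∎
    where open ≤-Reasoning

  colUses-map-≤ : ∀ (F : Rectangle r c Y → Rectangle r′ c′ Y′) C {t t′} →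
                  (∀ R → T (F R) t ≡ true → T R t′ ≡ true) → colUses (map F C) t ≤ colUses C t′
  colUses-map-≤ F C {t} {t′} F⇒ = begin
    colUses (map F C) t             ≡⟨ colUses-count (map F C) t ⟩
    count (λ R → T R t) (map F C)   ≡⟨ count-map (λ R → T R t) F C ⟩
    count (λ R → T (F R) t) C       ≤⟨ count-mono _ _ C F⇒ ⟩
    count (λ R → T R t′) C          ≡⟨ colUses-count C t′ ⟨
    colUses C t′                    ∎
    where open ≤-Reasoning

record IsPreimage (r′ c′ : ℕ) (Y′ : Diagram) (f g : ℕ → ℕ) (Y : Diagram) : Set where
  field
    reflect  : ∀ {s t} → 1 ≤ s → s ≤ r′ → 1 ≤ t → t ≤ c′ → Y (f s) (g t) ≡ true → Y′ s t ≡ true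
    preserve : ∀ {s t} → Y′ s t ≡ true → Y (f s) (g t) ≡ true

inRange : ℕ → ℕ → Bool
inRange n s = (1 ≤ᵇ s) ∧ (s ≤ᵇ n)

inRange⁺ : ∀ {n s} → 1 ≤ s → s ≤ n → inRange n s ≡ true
inRange⁺ 1≤s s≤n = ∧-true⁺ (≤ᵇ-true⁺ 1≤s) (≤ᵇ-true⁺ s≤n)

inRange⁻ : ∀ {n s} → inRange n s ≡ true → 1 ≤ s × s ≤ n
inRange⁻ {n} {s} e with ∧-true⁻ {1 ≤ᵇ s} e
... | e₁ , e₂ = ≤ᵇ-true⁻ e₁ , ≤ᵇ-true⁻ e₂

module _ {r c r′ c′ : ℕ} {Y Y′ : Diagram} {f g : ℕ → ℕ} (pre : IsPreimage r′ c′ Y′ f g Y) where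
  open IsPreimage pre

  preimage : Rectangle r c Y → Rectangle r′ c′ Y′
  preimage R = record
    { S     = λ s → inRange r′ s ∧ S R (f s)
    ; T     = λ t → inRange c′ t ∧ T R (g t)
    ; S-sub = λ s → inRange⁻ ∘ proj₁ ∘ ∧-true⁻
    ; T-sub = λ t → inRange⁻ ∘ proj₁ ∘ ∧-true⁻
    ; inY   = λ s t es et → let (s∈ , Sfs) = ∧-true⁻ es ; (t∈ , Tgt) = ∧-true⁻ et in
        reflect (proj₁ (inRange⁻ s∈)) (proj₂ (inRange⁻ s∈)) (proj₁ (inRange⁻ t∈)) (proj₂ (inRange⁻ t∈))
                (inY R (f s) (g t) Sfs Tgt)
    }

  preimage-localCover : ∀ {i j C} → IsYoungDiagram r′ c′ Y′ → IsLocalCover r c Y i j C →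
                        IsLocalCover r′ c′ Y′ i j (map preimage C)
  preimage-localCover {i} {j} {C} yd′ lc = record
    { covers   = covers′
    ; rowLocal = λ s → ≤-trans (rowUses-map-≤ preimage C (λ _ → proj₂ ∘ ∧-true⁻)) (rowLocal lc (f s))
    ; colLocal = λ t → ≤-trans (colUses-map-≤ preimage C (λ _ → proj₂ ∘ ∧-true⁻)) (colLocal lc (g t))
    }
    where
    covers′ : ∀ s t → Y′ s t ≡ true → ∃ λ R → R ∈ map preimage C × S R s ≡ true × T R t ≡ true
    covers′ s t e with bounded yd′ s t e | covers lc (f s) (g t) (preserve e)
    ... | (1≤s , s≤r′) , (1≤t , t≤c′) | R , R∈C , Sfs , Tgt =
      preimage R , ∈-map⁺ preimage R∈C , ∧-true⁺ (inRange⁺ 1≤s s≤r′) Sfs , ∧-true⁺ (inRange⁺ 1≤t t≤c′) Tgt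

module _ {r c : ℕ} {Y : Diagram} (yd : IsYoungDiagram r c Y) where

  lastRow : Rectangle r c Y → ℕ
  lastRow R = greatest (S R) r

  unionAt : (Rectangle r c Y → ℕ → Bool) → List (Rectangle r c Y) → ℕ → ℕ → Bool
  unionAt uses D k x = any (λ R → (lastRow R ≡ᵇ k) ∧ uses R x) D

  -- The rectangles of D with last row k all have their columns in row k, so the product of
  -- the union of their rows and the union of their columns still lies in Y.
  merge : List (Rectangle r c Y) → ℕ → Rectangle r c Y
  merge D k = record
    { S     = unionAt S D k
    ; T     = unionAt T D k
    ; S-sub = λ s e → let (R , e′) = any-true⁻ _ D e in S-sub R s (proj₂ (∧-true⁻ e′))
    ; T-sub = λ t e → let (R , e′) = any-true⁻ _ D e in T-sub R t (proj₂ (∧-true⁻ e′))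
    ; inY   = λ s t es et → merge-inY (any-true⁻ _ D es) (any-true⁻ _ D et)
    }
    where
    merge-inY : ∀ {s t} → (∃ λ R → (lastRow R ≡ᵇ k) ∧ S R s ≡ true) →
                          (∃ λ R → (lastRow R ≡ᵇ k) ∧ T R t ≡ true) → Y s t ≡ true
    merge-inY {s} {t} (R₁ , e₁) (R₂ , e₂) with ∧-true⁻ e₁ | ∧-true⁻ e₂
    ... | last₁ , Ss | last₂ , Tt = down-rows yd 1≤s s≤k (inY R₂ k t Sk Tt)
      where
      1≤s = proj₁ (S-sub R₁ s Ss)
      s≤k : s ≤ k
      s≤k = subst (s ≤_) (≡ᵇ-true⁻ last₁) (≤-greatest (S R₁) r Ss (proj₂ (S-sub R₁ s Ss)))
      Sk : S R₂ k ≡ true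
      Sk = subst (λ k′ → S R₂ k′ ≡ true) (≡ᵇ-true⁻ last₂)
                 (greatest-true (S R₂) r (subst (1 ≤_) (sym (≡ᵇ-true⁻ last₂)) (≤-trans 1≤s s≤k)))

  unionAt-count : ∀ (uses : Rectangle r c Y → ℕ → Bool) D x →
                  count (λ k → unionAt uses D k x) (range1 r) ≤ count (λ R → uses R x) D
  unionAt-count uses []      x = ≤-reflexive (count-none _ (range1 r) (λ _ → refl))
  unionAt-count uses (R ∷ D) x = begin
    count (λ k → (lastRow R ≡ᵇ k) ∧ uses R x ∨ unionAt uses D k x) (range1 r)
      ≤⟨ count-∨ _ _ (range1 r) ⟩
    count (λ k → (lastRow R ≡ᵇ k) ∧ uses R x) (range1 r) + count (λ k → unionAt uses D k x) (range1 r)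
      ≤⟨ +-mono-≤ (count-≡ᵇ-∧-≤ (lastRow R) r (uses R x)) (unionAt-count uses D x) ⟩
    (if uses R x then 1 else 0) + count (λ R′ → uses R′ x) D
      ∎
    where open ≤-Reasoning

  rowUses-merge : ∀ D s → rowUses (map (merge D) (range1 r)) s ≤ rowUses D s
  rowUses-merge D s = begin
    rowUses (map (merge D) (range1 r)) s              ≡⟨ rowUses-count (map (merge D) (range1 r)) s ⟩
    count (λ R → S R s) (map (merge D) (range1 r))    ≡⟨ count-map _ (merge D) (range1 r) ⟩
    count (λ k → unionAt S D k s) (range1 r)          ≤⟨ unionAt-count S D s ⟩
    count (λ R → S R s) D                             ≡⟨ rowUses-count D s ⟨
    rowUses D s                                       ∎
    where open ≤-Reasoning

  colUses-merge : ∀ D t → colUses (map (merge D) (range1 r)) t ≤ colUses D t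
  colUses-merge D t = begin
    colUses (map (merge D) (range1 r)) t              ≡⟨ colUses-count (map (merge D) (range1 r)) t ⟩
    count (λ R → T R t) (map (merge D) (range1 r))    ≡⟨ count-map _ (merge D) (range1 r) ⟩
    count (λ k → unionAt T D k t) (range1 r)          ≤⟨ unionAt-count T D t ⟩
    count (λ R → T R t) D                             ≡⟨ colUses-count D t ⟨
    colUses D t                                       ∎
    where open ≤-Reasoning

  merge-localCover : ∀ {i j D} → IsLocalCover r c Y i j D → IsLocalCover r c Y i j (map (merge D) (range1 r))
  merge-localCover {i} {j} {D} lc = record
    { covers   = covers′
    ; rowLocal = λ s → ≤-trans (rowUses-merge D s) (rowLocal lc s)
    ; colLocal = λ t → ≤-trans (colUses-merge D t) (colLocal lc t)
    }
    where
    covers′ : ∀ s t → Y s t ≡ true → ∃ λ R → R ∈ map (merge D) (range1 r) × S R s ≡ true × T R t ≡ true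
    covers′ s t e with covers lc s t e
    ... | R , R∈D , Ss , Tt = merge D k , ∈-map⁺ (merge D) (∈-range1 1≤k k≤r) ,
      any-true⁺ _ R∈D (∧-true⁺ (≡ᵇ-refl k) Ss) , any-true⁺ _ R∈D (∧-true⁺ (≡ᵇ-refl k) Tt)
      where
      k = lastRow R
      s≤k : s ≤ k
      s≤k = ≤-greatest (S R) r Ss (proj₂ (S-sub R s Ss))
      1≤k = ≤-trans (proj₁ (S-sub R s Ss)) s≤k
      k≤r = greatest-≤ (S R) r

  length-merge : ∀ D → length (map (merge D) (range1 r)) ≡ r
  length-merge D = trans (length-map (merge D) (range1 r)) (trans (length-map suc (upTo r)) (length-upTo r))

-- The corners (p a, q b) with a + b = z + 1 are the steps of Y, listed from top right to bottom left.
record Staircase (Y : Diagram) (z : ℕ) : Set where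
  field
    p q          : ℕ → ℕ
    p-increasing : ∀ {a b} → 1 ≤ a → b ≤ z → a < b → p a < p b
    q-increasing : ∀ {a b} → 1 ≤ a → b ≤ z → a < b → q a < q b
    corner       : ∀ {a b} → 1 ≤ a → 1 ≤ b → a + b ≡ suc z → Y (p a) (q b) ≡ true
    below-corner : ∀ {s t} → 1 ≤ s → 1 ≤ t → Y s t ≡ true →
                   ∃₂ λ a b → (1 ≤ a × 1 ≤ b) × a + b ≡ suc z × s ≤ p a × t ≤ q b

module StaircaseProperties {r c : ℕ} {Y : Diagram} (yd : IsYoungDiagram r c Y) {z : ℕ} (st : Staircase Y z) where
  open Staircase st

  p-pos : ∀ {a} → 1 ≤ a → a ≤ z → 1 ≤ p a
  p-pos 1≤a a≤z with complement 1≤a a≤z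
  ... | b , 1≤b , a+b = proj₁ (proj₁ (bounded yd _ _ (corner 1≤a 1≤b a+b)))

  q-pos : ∀ {b} → 1 ≤ b → b ≤ z → 1 ≤ q b
  q-pos {b} 1≤b b≤z with complement 1≤b b≤z
  ... | a , 1≤a , b+a = proj₁ (proj₂ (bounded yd _ _ (corner 1≤a 1≤b (trans (+-comm a b) b+a))))

  q-mono : ∀ {a b} → 1 ≤ a → b ≤ z → a ≤ b → q a ≤ q b
  q-mono 1≤a b≤z a≤b with m≤n⇒m<n∨m≡n a≤b
  ... | inj₁ a<b  = <⇒≤ (q-increasing 1≤a b≤z a<b)
  ... | inj₂ refl = ≤-refl

  p-reflects-≤ : ∀ {a a′} → 1 ≤ a′ → a ≤ z → p a ≤ p a′ → a ≤ a′
  p-reflects-≤ 1≤a′ a≤z pa≤pa′ = ≮⇒≥ λ a′<a → <⇒≱ (p-increasing 1≤a′ a≤z a′<a) pa≤pa′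

  q-reflects-≤ : ∀ {b b′} → 1 ≤ b′ → b ≤ z → q b ≤ q b′ → b ≤ b′
  q-reflects-≤ 1≤b′ b≤z qb≤qb′ = ≮⇒≥ λ b′<b → <⇒≱ (q-increasing 1≤b′ b≤z b′<b) qb≤qb′

  corner-cell⁻ : ∀ {a b} → 1 ≤ a → a ≤ z → 1 ≤ b → b ≤ z → Y (p a) (q b) ≡ true → a + b ≤ suc z
  corner-cell⁻ 1≤a a≤z 1≤b b≤z e with below-corner (p-pos 1≤a a≤z) (q-pos 1≤b b≤z) e
  ... | a′ , b′ , (1≤a′ , 1≤b′) , a′+b′ , pa≤ , qb≤ =
    ≤-trans (+-mono-≤ (p-reflects-≤ 1≤a′ a≤z pa≤) (q-reflects-≤ 1≤b′ b≤z qb≤)) (≤-reflexive a′+b′)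

  corner-cell⁺ : ∀ {a b} → 1 ≤ a → 1 ≤ b → a + b ≤ suc z → Y (p a) (q b) ≡ true
  corner-cell⁺ {a} {b} 1≤a 1≤b a+b≤ with complement 1≤a (sum≤suc⇒≤ˡ 1≤b a+b≤)
  ... | b′ , 1≤b′ , a+b′ =
    down-cols yd (q-pos 1≤b (≤-trans b≤b′ b′≤z)) (q-mono 1≤b b′≤z b≤b′) (corner 1≤a 1≤b′ a+b′)
    where
    b≤b′ : b ≤ b′
    b≤b′ = +-cancelˡ-≤ a b b′ (≤-trans a+b≤ (≤-reflexive (sym a+b′)))
    b′≤z : b′ ≤ z
    b′≤z = sum≤suc⇒≤ʳ 1≤a (≤-reflexive a+b′)

  φ ψ : ℕ → ℕ
  φ s = least (λ a → s ≤ᵇ p a) z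
  ψ t = least (λ b → t ≤ᵇ q b) z

  φ+ψ≤ : ∀ {s t} → 1 ≤ s → 1 ≤ t → Y s t ≡ true → φ s + ψ t ≤ suc z
  φ+ψ≤ 1≤s 1≤t e with below-corner 1≤s 1≤t e
  ... | a , b , (1≤a , 1≤b) , a+b , s≤pa , t≤qb = ≤-trans
    (+-mono-≤ (least-minimal _ z 1≤a (sum≤suc⇒≤ˡ 1≤b (≤-reflexive a+b)) (≤ᵇ-true⁺ s≤pa))
              (least-minimal _ z 1≤b (sum≤suc⇒≤ʳ 1≤a (≤-reflexive a+b)) (≤ᵇ-true⁺ t≤qb)))
    (≤-reflexive a+b)

  φ+ψ≤⇒cell : ∀ {s t} → 1 ≤ s → 1 ≤ t → φ s + ψ t ≤ suc z → Y s t ≡ true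
  φ+ψ≤⇒cell {s} {t} 1≤s 1≤t φ+ψ≤′ =
    down-rows yd 1≤s s≤pφ (down-cols yd 1≤t t≤qψ (corner-cell⁺ 1≤φ 1≤ψ φ+ψ≤′))
    where
    1≤φ = 1≤least (λ a → s ≤ᵇ p a) z
    1≤ψ = 1≤least (λ b → t ≤ᵇ q b) z
    s≤pφ : s ≤ p (φ s)
    s≤pφ = ≤ᵇ-true⁻ (least-true _ z (sum≤suc⇒≤ˡ 1≤ψ φ+ψ≤′))
    t≤qψ : t ≤ q (ψ t)
    t≤qψ = ≤ᵇ-true⁻ (least-true _ z (sum≤suc⇒≤ʳ 1≤φ φ+ψ≤′))

  Ystair-isPreimage : IsPreimage z z (Ystair z) p q Y
  Ystair-isPreimage = record
    { reflect  = λ 1≤a a≤z 1≤b b≤z e → Ystair⁺ 1≤a 1≤b (corner-cell⁻ 1≤a a≤z 1≤b b≤z e)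
    ; preserve = λ e → let ((1≤a , 1≤b) , a+b≤) = Ystair⁻ e in corner-cell⁺ 1≤a 1≤b a+b≤
    }

  Y-isPreimage : IsPreimage r c Y φ ψ (Ystair z)
  Y-isPreimage = record
    { reflect  = λ {s} {t} 1≤s _ 1≤t _ e → φ+ψ≤⇒cell 1≤s 1≤t (proj₂ (Ystair⁻ {z} {φ s} {ψ t} e))
    ; preserve = λ {s} {t} e → let ((1≤s , _) , (1≤t , _)) = bounded yd s t e in
        Ystair⁺ (1≤least _ z) (1≤least _ z) (φ+ψ≤ 1≤s 1≤t e)
    }

dropRow : Diagram → Diagram
dropRow Y zero    t = false
dropRow Y (suc s) t = Y (suc (suc s)) t

dropRow-young : ∀ {r c Y} → IsYoungDiagram (suc r) c Y → IsYoungDiagram r c (dropRow Y)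
dropRow-young {r} {c} {Y} yd = record { bounded = bounded′ ; down-row = down-row′ ; down-col = down-col′ }
  where
  bounded′ : ∀ s t → dropRow Y s t ≡ true → (1 ≤ s × s ≤ r) × (1 ≤ t × t ≤ c)
  bounded′ (suc s) t e with bounded yd (suc (suc s)) t e
  ... | (_ , s≤s s<r) , t-bounds = (s≤s z≤n , s<r) , t-bounds
  down-row′ : ∀ s t → dropRow Y (suc s) t ≡ true → 1 ≤ s → dropRow Y s t ≡ true
  down-row′ (suc s) t e _ = down-row yd (suc (suc s)) t e (s≤s z≤n)
  down-col′ : ∀ s t → dropRow Y s (suc t) ≡ true → 1 ≤ t → dropRow Y s t ≡ true
  down-col′ (suc s) t e 1≤t = down-col yd (suc (suc s)) t e 1≤t

dropRow⁻ : ∀ {Y s t} → 1 ≤ s → dropRow Y s t ≡ true → Y (suc s) t ≡ true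
dropRow⁻ {s = suc s} _ e = e

rowSteps : ℕ → Diagram → ℕ → ℕ
rowSteps c Y s = count (isStep Y s) (range1 c)

numSteps-suc : ∀ r c Y → numSteps (suc r) c Y ≡ rowSteps c Y 1 + numSteps r c (dropRow Y)
numSteps-suc r c Y = cong sum (begin
  map (rowSteps c Y) (range1 (suc r))                      ≡⟨ map-range1 (rowSteps c Y) (suc r) ⟩
  rowSteps c Y 1 ∷ applyUpTo (rowSteps c Y ∘ suc ∘ suc) r  ≡⟨ cong (_ ∷_) (map-range1 (rowSteps c (dropRow Y)) r) ⟨
  rowSteps c Y 1 ∷ map (rowSteps c (dropRow Y)) (range1 r) ∎)
  where open ≡-Reasoning

rowSteps-none : ∀ c Y s → (∀ {t} → Y s t ≡ true → Y (suc s) t ≡ true) → rowSteps c Y s ≡ 0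
rowSteps-none c Y s row≤next = count-none (isStep Y s) (range1 c) not-step
  where
  not-step : ∀ t → isStep Y s t ≡ false
  not-step t with Y s t in e
  ... | true  rewrite row≤next e = refl
  ... | false = refl

rowSteps-one : ∀ {r c Y s L} → IsYoungDiagram r c Y → Y s L ≡ true → Y (suc s) L ≡ false →
               (∀ {t} → Y s t ≡ true → t ≤ L) → rowSteps c Y s ≡ 1
rowSteps-one {L = zero} yd YsL _ _ = ⊥-elim (1+n≰n (proj₁ (proj₂ (bounded yd _ zero YsL))))
rowSteps-one {r} {c} {Y} {s} {suc m} yd YsL Ys′L L-max = begin
  rowSteps c Y s                    ≡⟨ cong sum (map-range1 stepAt c) ⟩
  sum (applyUpTo (stepAt ∘ suc) c)  ≡⟨ sum-applyUpTo-single-< (stepAt ∘ suc) m<c off-L ⟩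
  stepAt (suc m)                    ≡⟨ at-L ⟩
  1                                 ∎
  where
  open ≡-Reasoning
  stepAt : ℕ → ℕ
  stepAt t = if isStep Y s t then 1 else 0
  m<c : m < c
  m<c = proj₂ (proj₂ (bounded yd s (suc m) YsL))
  off-L : ∀ i → i ≢ m → stepAt (suc i) ≡ 0
  off-L i i≢m with <-cmp i m
  ... | tri≈ _ i≡m _ = ⊥-elim (i≢m i≡m)
  ... | tri< i<m _ _ rewrite down-cols yd (s≤s z≤n) (s≤s i<m) YsL
                           | ∧-zeroʳ (not (Y (suc s) (suc i))) | ∧-zeroʳ (Y s (suc i)) = refl
  ... | tri> _ _ m<i with Y s (suc i) in e
  ... | true  = ⊥-elim (<⇒≱ (s≤s m<i) (L-max e))
  ... | false = refl
  at-L : stepAt (suc m) ≡ 1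
  at-L with Y s (suc (suc m)) in e
  ... | true  = ⊥-elim (1+n≰n (L-max e))
  ... | false rewrite YsL | Ys′L = refl

module _ {r c : ℕ} {Y : Diagram} (yd : IsYoungDiagram (suc r) c Y) {z : ℕ} (st : Staircase (dropRow Y) z) where
  open Staircase st
  open StaircaseProperties (dropRow-young yd) st using (p-pos)

  corner-row-pos : ∀ {a b} → 1 ≤ a → 1 ≤ b → a + b ≡ suc z → 1 ≤ p a
  corner-row-pos 1≤a 1≤b a+b = p-pos 1≤a (sum≤suc⇒≤ˡ 1≤b (≤-reflexive a+b))

  lowered-corner : ∀ {a b} → 1 ≤ a → 1 ≤ b → a + b ≡ suc z → Y (suc (p a)) (q b) ≡ true
  lowered-corner 1≤a 1≤b a+b = dropRow⁻ (corner-row-pos 1≤a 1≤b a+b) (corner 1≤a 1≤b a+b)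

  addRow : (∀ {t} → Y 1 t ≡ true → Y 2 t ≡ true) → Staircase Y z
  addRow row₁≤row₂ = record
    { p            = suc ∘ p
    ; q            = q
    ; p-increasing = λ 1≤a b≤z a<b → s≤s (p-increasing 1≤a b≤z a<b)
    ; q-increasing = q-increasing
    ; corner       = lowered-corner
    ; below-corner = below-corner′
    }
    where
    below-corner′ : ∀ {s t} → 1 ≤ s → 1 ≤ t → Y s t ≡ true →
                    ∃₂ λ a b → (1 ≤ a × 1 ≤ b) × a + b ≡ suc z × s ≤ suc (p a) × t ≤ q b
    below-corner′ {suc zero} 1≤s 1≤t e with below-corner (s≤s z≤n) 1≤t (row₁≤row₂ e)
    ... | a , b , bounds , a+b , _ , t≤qb = a , b , bounds , a+b , s≤s z≤n , t≤qb
    below-corner′ {suc (suc s)} 1≤s 1≤t e with below-corner (s≤s z≤n) 1≤t e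
    ... | a , b , bounds , a+b , s≤pa , t≤qb = a , b , bounds , a+b , s≤s s≤pa , t≤qb

  -- The new step (1, L) becomes the corner a = 1, b = z + 1; the old corners move one row down.
  addStep : ∀ {L} → Y 1 L ≡ true → Y 2 L ≡ false → (∀ {t} → Y 1 t ≡ true → t ≤ L) → Staircase Y (suc z)
  addStep {L} Y₁L Y₂L L-max = record
    { p            = P
    ; q            = Q
    ; p-increasing = P-increasing
    ; q-increasing = Q-increasing
    ; corner       = corner′
    ; below-corner = below-corner′
    }
    where
    P : ℕ → ℕ
    P zero          = zero
    P (suc zero)    = 1
    P (suc (suc a)) = suc (p (suc a))

    Q : ℕ → ℕ
    Q b = if b ≤ᵇ z then q b else L

    Q-old : ∀ {b} → b ≤ z → Q b ≡ q b
    Q-old b≤z rewrite ≤ᵇ-true⁺ b≤z = refl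

    Q-new : Q (suc z) ≡ L
    Q-new with suc z ≤ᵇ z in e
    ... | true  = ⊥-elim (1+n≰n (≤ᵇ-true⁻ {suc z} e))
    ... | false = refl

    1≤L : 1 ≤ L
    1≤L = proj₁ (proj₂ (bounded yd 1 L Y₁L))

    -- Every old corner lies in row 2 or below, and row 2 stops before column L.
    q<L : ∀ {b} → 1 ≤ b → b ≤ z → q b < L
    q<L 1≤b b≤z with complement 1≤b b≤z
    ... | a , 1≤a , b+a = ≰⇒> λ L≤qb → true≢false (trans (sym (down-cols yd 1≤L L≤qb Y₂qb)) Y₂L)
      where
      a+b = trans (+-comm a _) b+a
      Y₂qb = down-rows yd (s≤s z≤n) (s≤s (corner-row-pos 1≤a 1≤b a+b)) (lowered-corner 1≤a 1≤b a+b)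

    P-increasing : ∀ {a b} → 1 ≤ a → b ≤ suc z → a < b → P a < P b
    P-increasing {suc zero}    {suc (suc b)} _ b≤ _         = s≤s (p-pos (s≤s z≤n) (≤-pred b≤))
    P-increasing {suc (suc a)} {suc (suc b)} _ b≤ (s≤s a<b) = s≤s (p-increasing (s≤s z≤n) (≤-pred b≤) a<b)
    P-increasing {suc zero}    {suc zero}    _ _  (s≤s ())
    P-increasing {suc (suc a)} {suc zero}    _ _  (s≤s ())

    Q-increasing : ∀ {a b} → 1 ≤ a → b ≤ suc z → a < b → Q a < Q b
    Q-increasing 1≤a b≤ a<b rewrite Q-old (≤-pred (≤-trans a<b b≤)) with m≤n⇒m<n∨m≡n b≤
    ... | inj₁ (s≤s b≤z) rewrite Q-old b≤z = q-increasing 1≤a b≤z a<b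
    ... | inj₂ refl      rewrite Q-new     = q<L 1≤a (≤-pred a<b)

    corner′ : ∀ {a b} → 1 ≤ a → 1 ≤ b → a + b ≡ suc (suc z) → Y (P a) (Q b) ≡ true
    corner′ {suc zero}    _ _   a+b rewrite suc-injective a+b | Q-new = Y₁L
    corner′ {suc (suc a)} _ 1≤b a+b
      rewrite Q-old (sum≤suc⇒≤ʳ (s≤s (z≤n {a})) (≤-reflexive (suc-injective a+b))) =
      lowered-corner (s≤s z≤n) 1≤b (suc-injective a+b)

    below-corner′ : ∀ {s t} → 1 ≤ s → 1 ≤ t → Y s t ≡ true →
                    ∃₂ λ a b → (1 ≤ a × 1 ≤ b) × a + b ≡ suc (suc z) × s ≤ P a × t ≤ Q b
    below-corner′ {suc zero} {t} _ _ e =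
      1 , suc z , (s≤s z≤n , s≤s z≤n) , refl , s≤s z≤n , subst (t ≤_) (sym Q-new) (L-max e)
    below-corner′ {suc (suc s)} {t} _ 1≤t e with below-corner (s≤s z≤n) 1≤t e
    ... | suc a , b , (_ , 1≤b) , a+b , s≤pa , t≤qb =
      suc (suc a) , b , (s≤s z≤n , 1≤b) , cong suc a+b , s≤s s≤pa ,
      subst (t ≤_) (sym (Q-old (sum≤suc⇒≤ʳ (s≤s z≤n) (≤-reflexive a+b)))) t≤qb

staircase : ∀ r c Y → IsYoungDiagram r c Y → Staircase Y (numSteps r c Y)
staircase zero c Y yd = record
  { p            = λ _ → 0
  ; q            = λ _ → 0
  ; p-increasing = λ { _ z≤n () }
  ; q-increasing = λ { _ z≤n () }
  ; corner       = λ 1≤a 1≤b a+b → ⊥-elim (1+n≰n (≤-trans (+-mono-≤ 1≤a 1≤b) (≤-reflexive a+b)))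
  ; below-corner = λ 1≤s _ e → ⊥-elim (1+n≰n (≤-trans 1≤s (proj₂ (proj₁ (bounded yd _ _ e)))))
  }
staircase (suc r) c Y yd = subst (Staircase Y) (sym (numSteps-suc r c Y)) extended
  where
  st = staircase r c (dropRow Y) (dropRow-young yd)
  L = greatest (Y 1) c
  L-max : ∀ {t} → Y 1 t ≡ true → t ≤ L
  L-max e = ≤-greatest (Y 1) c e (proj₂ (proj₂ (bounded yd 1 _ e)))
  firstRow-cases : (∀ {t} → Y 1 t ≡ true → Y 2 t ≡ true) ⊎ (Y 1 L ≡ true × Y 2 L ≡ false)
  firstRow-cases with Y 2 L in e₂
  ... | true  = inj₁ λ e → down-cols yd (proj₁ (proj₂ (bounded yd 1 _ e))) (L-max e) e₂
  ... | false with m≤n⇒m<n∨m≡n (z≤n {L})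
  ... | inj₁ 1≤L = inj₂ (greatest-true (Y 1) c 1≤L , refl)
  ... | inj₂ 0≡L = inj₁ λ e →
    ⊥-elim (1+n≰n (≤-trans (proj₁ (proj₂ (bounded yd 1 _ e))) (subst (_ ≤_) (sym 0≡L) (L-max e))))
  extended : Staircase Y (rowSteps c Y 1 + numSteps r c (dropRow Y))
  extended with firstRow-cases
  ... | inj₁ row₁≤row₂ rewrite rowSteps-none c Y 1 row₁≤row₂ = addRow yd st row₁≤row₂
  ... | inj₂ (Y₁L , Y₂L) rewrite rowSteps-one yd Y₁L Y₂L L-max = addStep yd st Y₁L Y₂L L-max

lemma2 : (i j z r c : ℕ) (Y : Diagram) → IsYoungDiagram r c Y → numSteps r c Y ≡ z →
    (Σ (List (Rectangle r c Y)) (IsLocalCover r c Y i j)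
      ⇔ Σ (List (Rectangle z z (Ystair z))) (λ C → IsLocalCover z z (Ystair z) i j C × length C ≡ z))
lemma2 i j z r c Y yd refl = mk⇔
  (λ (C , lc) → let D = map (preimage Ystair-isPreimage) C in
    map (merge Yz D) (range1 z) ,
    merge-localCover Yz (preimage-localCover Ystair-isPreimage Yz lc) ,
    length-merge Yz D)
  (λ (D , lc , _) → map (preimage Y-isPreimage) D , preimage-localCover Y-isPreimage yd lc)
  where
  open StaircaseProperties yd (staircase r c Y yd)
  Yz = Ystair-young z
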